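{- As formal power series in $z$ and $q$, $$J(z;q) := \sum_{m,n\geq 0} j(m,n)\, z^m q^n = \frac{(-zq;q)_\infty}{(z^2q;q)_\infty}.$$
   Context: A 01-partition (jagged partition) of a non-negative integer $n$ is a finite sequence $(n_1,\dots,n_m)$ of non-negative integers with $\sum_i n_i = n$, whose last entry satisfies $n_m \geq 1$, and such that $n_j \geq n_{j+1}-1$ and $n_j \geq n_{j+2}$ whenever the indices are in range; $m$ is its length. The empty sequence is the unique 01-partition of $0$, of length $0$. $j(m,n)$ is the number of 01-partitions of $n$ of length exactly $m$. Notation: $(a;q)_\infty = \prod_{i\ge0}(1-aq^i)$. -}

module Defs where

open import Data.Bool using (Bool; true; false; _∧_; if_then_else_)
open import Data.Nat using (ℕ; zero; suc; _+_; _∸_; _≤ᵇ_; _≡ᵇ_)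
open import Data.List using (List; []; _∷_; map; concatMap; upTo; filter; length; foldr)
open import Data.Nat.ListAction using (sum)
open import Data.Integer using (ℤ; +_; -_) renaming (_+_ to _+ℤ_; _*_ to _*ℤ_)
open import Relation.Nullary.Decidable using (Dec)
open import Relation.Binary.PropositionalEquality using (_≡_; refl)
open import Data.Bool using (T)
open import Data.Bool.Properties using (T?)

localOK : List ℕ → Bool
localOK (a ∷ b ∷ c ∷ r) = (b ≤ᵇ suc a) ∧ (c ≤ᵇ a) ∧ localOK (b ∷ c ∷ r)
localOK (a ∷ b ∷ [])    = b ≤ᵇ suc a
localOK _               = true

lastPos : List ℕ → Bool
lastPos []          = true
lastPos (x ∷ [])    = 1 ≤ᵇ x
lastPos (x ∷ y ∷ r) = lastPos (y ∷ r)

is01Partition : ℕ → List ℕ → Bool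
is01Partition n xs = (sum xs ≡ᵇ n) ∧ lastPos xs ∧ localOK xs

seqs : ℕ → ℕ → List (List ℕ)
seqs zero    k = [] ∷ []
seqs (suc m) k = concatMap (λ x → map (x ∷_) (seqs m k)) (upTo (suc k))

-- j(m,n): number of 01-partitions of n of length m
-- (every entry of such a sequence is ≤ n, so the enumeration is exhaustive).
j : ℕ → ℕ → ℕ
j m n = length (filter (λ xs → T? (is01Partition n xs)) (seqs m n))

-- Formal power series in z and q with integer coefficients:
-- f m n is the coefficient of z^m q^n.

Series : Set
Series = ℕ → ℕ → ℤ

sumTo : ℕ → (ℕ → ℤ) → ℤ
sumTo zero    f = f 0
sumTo (suc k) f = sumTo k f +ℤ f (suc k)

_⊕_ : Series → Series → Series
(f ⊕ g) m n = f m n +ℤ g m n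

_⊗_ : Series → Series → Series
(f ⊗ g) m n = sumTo m (λ a → sumTo n (λ b → f a b *ℤ g (m ∸ a) (n ∸ b)))

mono : ℤ → ℕ → ℕ → Series
mono c a b m n = if (m ≡ᵇ a) ∧ (n ≡ᵇ b) then c else + 0

one : Series
one = mono (+ 1) 0 0

prodBelow : ℕ → (ℕ → Series) → Series
prodBelow zero    f = one
prodBelow (suc k) f = prodBelow k f ⊗ f k

-- Infinite product ∏_{i≥0} f i, for families with f i ≡ 1 mod q^{i+1}
-- (so the coefficient of q^n stabilises after the factors 0,…,n).
infProd : (ℕ → Series) → Series
infProd f m n = prodBelow (suc n) f m n

-- (c z^a q^b ; q)_∞ = ∏_{i≥0} (1 - c z^a q^{b+i}), used with b ≥ 1.
qPochInf : ℤ → ℕ → ℕ → Series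
qPochInf c a b = infProd (λ i → one ⊕ mono (- c) a (b + i))

J : Series
J m n = + j m n

{-# OPTIONS --safe #-}
module Submission where

-- Call a finite sequence a 01-sequence if it satisfies the 01-conditions except possibly the one on
-- its last entry; these are the 01-partitions padded with zeros, so their generating function is
-- Λ = J/(1 - z). A 01-partition of n of length m either has only positive parts, and subtracting 1
-- from each part leaves a 01-sequence of n - m, or it ends in 0, 1, and removing these leaves a
-- 01-partition of n - 1 of length m - 2. Hence J(z,q)(1 - z²q) = Λ(zq,q), that is,
-- J(z,q)(1 - z²q)(1 - zq) = J(zq,q). Splitting off the first two factors of (z²q;q)∞ and using
-- 1 - z²q² = (1 - zq)(1 + zq) shows that T(z,q) = J(z,q)(z²q;q)∞ satisfies T(z,q) = (1 + zq) T(zq,q),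
-- and so does (-zq;q)∞. Such an equation determines a series from its z⁰-part by induction on the
-- power of q, and both series have z⁰-part 1.

open import Algebra.Bundles using (CommutativeMonoid; CommutativeSemiring)
open import Algebra.Core using (Op₂)
import Algebra.Construct.Pointwise as Pointwise
import Algebra.Properties.CommutativeSemigroup as CommutativeSemigroupProperties
import Algebra.Structures.Biased as Biased
open import Data.Bool using (Bool; true; false; if_then_else_; _∧_; _∨_; not; T)
open import Data.Bool.ListAction using (any)
open import Data.Bool.Properties using (T?; if-float; ∧-zeroʳ; ∧-identityʳ; ∧-assoc; ∧-comm; ∨-zeroʳ)
open import Data.Integer as ℤ using (ℤ; +_; -_)
import Data.Integer.Properties as ℤ
open import Data.Integer.Tactic.RingSolver using (solve-∀)
open import Data.List using (List; []; _∷_; _++_; _∷ʳ_; map; length; filter; concatMap; upTo)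
open import Data.List.Properties using (map-++; map-∘; upTo-∷ʳ; ++-assoc; length-++)
open import Data.List.Relation.Unary.All as All using (All; []; _∷_)
open import Data.Nat as ℕ using (ℕ; zero; suc; _∸_; _≤_; _<_; z≤n; s≤s; _≤ᵇ_; _≡ᵇ_)
open import Data.Nat.Induction using (<-rec)
open import Data.Nat.ListAction using (sum)
open import Data.Nat.ListAction.Properties using (sum-++)
open import Data.Nat.Properties as ℕ
  using (≤-refl; ≤-trans; ≤-antisym; m≤n⇒m≤1+n; m≤n⇒m<n∨m≡n; <⇒≢; +-∸-assoc; n∸n≡0; m∸[m∸n]≡n;
         m+[n∸m]≡n; m+n∸m≡n; ∸-+-assoc; ∸-monoʳ-<; +-suc; ≤ᵇ-reflects-≤; ≡ᵇ⇒≡; ≡⇒≡ᵇ)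
open import Data.Product using (_×_; _,_; proj₁; proj₂)
open import Data.Sum using (inj₁; inj₂)
open import Defs
open import Function using (_∘_)
open import Level using (0ℓ)
open import Relation.Binary.Core using (Rel)
open import Relation.Binary.PropositionalEquality as ≡ using (_≡_; _≢_)
import Relation.Binary.Reasoning.Setoid as SetoidReasoning
open import Relation.Nullary.Negation using (¬_; contradiction)
open import Relation.Nullary.Reflects using (Reflects; ofʸ; ofⁿ; fromEquivalence)

≡ᵇ-reflects-≡ : ∀ m n → Reflects (m ≡ n) (m ≡ᵇ n)
≡ᵇ-reflects-≡ m n = fromEquivalence (≡ᵇ⇒≡ m n) (≡⇒≡ᵇ m n)

≡ᵇ-false : ∀ {m n} → m ≢ n → (m ≡ᵇ n) ≡ false
≡ᵇ-false {m} {n} m≢n with m ≡ᵇ n | ≡ᵇ-reflects-≡ m n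
... | true  | ofʸ m≡n = contradiction m≡n m≢n
... | false | _       = ≡.refl

≡ᵇ-cong-⇔ : ∀ {m n m′ n′} → (m ≡ n → m′ ≡ n′) → (m′ ≡ n′ → m ≡ n) → (m ≡ᵇ n) ≡ (m′ ≡ᵇ n′)
≡ᵇ-cong-⇔ {m} {n} {m′} {n′} to from with m ≡ᵇ n | ≡ᵇ-reflects-≡ m n | m′ ≡ᵇ n′ | ≡ᵇ-reflects-≡ m′ n′
... | true  | _       | true  | _        = ≡.refl
... | false | _       | false | _        = ≡.refl
... | true  | ofʸ m≡n | false | ofⁿ m′≢n′ = contradiction (to m≡n) m′≢n′
... | false | ofⁿ m≢n | true  | ofʸ m′≡n′ = contradiction (from m′≡n′) m≢n

+-≡ᵇ : ∀ s m n → (s ℕ.+ m ≡ᵇ n) ≡ (m ≤ᵇ n) ∧ (s ≡ᵇ n ∸ m)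
+-≡ᵇ s m n with m ≤ᵇ n | ≤ᵇ-reflects-≤ m n
... | true  | ofʸ m≤n = ≡ᵇ-cong-⇔ (λ s+m≡n → ≡.trans (≡.sym (ℕ.m+n∸n≡m s m)) (≡.cong (_∸ m) s+m≡n))
                                  (λ s≡n∸m → ≡.trans (≡.cong (ℕ._+ m) s≡n∸m) (ℕ.m∸n+n≡m m≤n))
... | false | ofⁿ m≰n = ≡ᵇ-false (λ s+m≡n → m≰n (≡.subst (m ≤_) s+m≡n (ℕ.m≤n+m m s)))

≤ᵇ-suc : ∀ a b → (suc a ≤ᵇ suc b) ≡ (a ≤ᵇ b)
≤ᵇ-suc zero    b = ≡.refl
≤ᵇ-suc (suc a) b = ≡.refl

≤ᵇ-true⇒≤ : ∀ m n → (m ≤ᵇ n) ≡ true → m ≤ n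
≤ᵇ-true⇒≤ m n m≤ᵇn = ℕ.≤ᵇ⇒≤ m n (≡.subst T (≡.sym m≤ᵇn) _)

∧-true : ∀ t {u} → t ∧ u ≡ true → t ≡ true × u ≡ true
∧-true true u≡true = ≡.refl , u≡true

𝟙 : Bool → ℕ
𝟙 true  = 1
𝟙 false = 0

𝟙-false : ∀ {t} → t ≢ true → 𝟙 t ≡ 0
𝟙-false {true}  t≢true = contradiction ≡.refl t≢true
𝟙-false {false} _      = ≡.refl

𝟙-split : ∀ t u → 𝟙 t ≡ 𝟙 (t ∧ u) ℕ.+ 𝟙 (t ∧ not u)
𝟙-split false u     = ≡.refl
𝟙-split true  false = ≡.refl
𝟙-split true  true  = ≡.refl

-- Finite sums and Cauchy products

module Sums {c ℓ} (M : CommutativeMonoid c ℓ) where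

  open CommutativeMonoid M renaming (_∙_ to _+_; ε to 0#)
  open CommutativeSemigroupProperties commutativeSemigroup using (interchange)
  open SetoidReasoning setoid

  ∑≤ : ℕ → (ℕ → Carrier) → Carrier
  ∑≤ zero    f = f 0
  ∑≤ (suc k) f = ∑≤ k f + f (suc k)

  syntax ∑≤ k (λ i → x) = ∑[ i ≤ k ] x

  ∑-cong : ∀ k {f g : ℕ → Carrier} → (∀ i → i ≤ k → f i ≈ g i) → ∑≤ k f ≈ ∑≤ k g
  ∑-cong zero    f≈g = f≈g 0 z≤n
  ∑-cong (suc k) f≈g = ∙-cong (∑-cong k (λ i i≤k → f≈g i (m≤n⇒m≤1+n i≤k))) (f≈g (suc k) ≤-refl)

  ∑-distrib-+ : ∀ k (f g : ℕ → Carrier) → ∑[ i ≤ k ] (f i + g i) ≈ ∑≤ k f + ∑≤ k g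
  ∑-distrib-+ zero    f g = refl
  ∑-distrib-+ (suc k) f g = trans (∙-congʳ (∑-distrib-+ k f g)) (interchange _ _ _ _)

  ∑-zero : ∀ k (f : ℕ → Carrier) → (∀ i → i ≤ k → f i ≈ 0#) → ∑≤ k f ≈ 0#
  ∑-zero zero    f f≈0 = f≈0 0 z≤n
  ∑-zero (suc k) f f≈0 =
    trans (∙-cong (∑-zero k f (λ i i≤k → f≈0 i (m≤n⇒m≤1+n i≤k))) (f≈0 (suc k) ≤-refl)) (identityˡ 0#)

  ∑-single : ∀ {k} j (f : ℕ → Carrier) → j ≤ k → (∀ i → i ≤ k → i ≢ j → f i ≈ 0#) → ∑≤ k f ≈ f j
  ∑-single {zero}  zero f z≤n _ = refl
  ∑-single {suc k} j    f j≤k f≈0 with m≤n⇒m<n∨m≡n j≤k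
  ... | inj₁ (s≤s j≤k′) = begin
    ∑≤ k f + f (suc k) ≈⟨ ∙-cong (∑-single j f j≤k′ (λ i i≤k → f≈0 i (m≤n⇒m≤1+n i≤k)))
                                 (f≈0 (suc k) ≤-refl (λ k≡j → <⇒≢ (s≤s j≤k′) (≡.sym k≡j))) ⟩
    f j + 0#           ≈⟨ identityʳ (f j) ⟩
    f j                ∎
  ... | inj₂ ≡.refl = begin
    ∑≤ k f + f (suc k) ≈⟨ ∙-congʳ (∑-zero k f (λ i i≤k → f≈0 i (m≤n⇒m≤1+n i≤k) (<⇒≢ (s≤s i≤k)))) ⟩
    0# + f (suc k)     ≈⟨ identityˡ _ ⟩
    f (suc k)          ∎

  ∑-uncons : ∀ k (f : ℕ → Carrier) → ∑≤ (suc k) f ≈ f 0 + ∑[ i ≤ k ] f (suc i)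
  ∑-uncons zero    f = refl
  ∑-uncons (suc k) f = trans (∙-congʳ (∑-uncons k f)) (assoc _ _ _)

  ∑-reverse : ∀ k (f : ℕ → Carrier) → ∑≤ k f ≈ ∑[ i ≤ k ] f (k ∸ i)
  ∑-reverse zero    f = refl
  ∑-reverse (suc k) f = begin
    ∑≤ (suc k) f                             ≈⟨ ∑-uncons k f ⟩
    f 0 + ∑[ i ≤ k ] f (suc i)               ≈⟨ ∙-congˡ (∑-reverse k (λ i → f (suc i))) ⟩
    f 0 + ∑[ i ≤ k ] f (suc (k ∸ i))         ≈⟨ comm _ _ ⟩
    ∑[ i ≤ k ] f (suc (k ∸ i)) + f 0         ≈⟨ ∙-cong (∑-cong k (λ i i≤k → reflexive (≡.cong f (≡.sym (+-∸-assoc 1 i≤k)))))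
                                                       (reflexive (≡.cong f (≡.sym (n∸n≡0 k)))) ⟩
    ∑[ i ≤ suc k ] f (suc k ∸ i)             ∎

  ∑-triangle : ∀ k (h : ℕ → ℕ → Carrier) →
               ∑[ a ≤ k ] ∑[ b ≤ a ] h a b ≈ ∑[ b ≤ k ] ∑[ c ≤ k ∸ b ] h (b ℕ.+ c) b
  ∑-triangle zero    h = refl
  ∑-triangle (suc k) h = begin
    ∑[ a ≤ k ] ∑[ b ≤ a ] h a b + (∑≤ k (h (suc k)) + h (suc k) (suc k))
      ≈⟨ ∙-congʳ (∑-triangle k h) ⟩
    ∑≤ k column + (∑≤ k (h (suc k)) + h (suc k) (suc k))
      ≈⟨ sym (assoc _ _ _) ⟩
    (∑≤ k column + ∑≤ k (h (suc k))) + h (suc k) (suc k)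
      ≈⟨ ∙-cong (sym (∑-distrib-+ k column (h (suc k))))
                (reflexive (≡.cong (λ a → h a (suc k)) (≡.sym (ℕ.+-identityʳ (suc k))))) ⟩
    ∑[ b ≤ k ] (column b + h (suc k) b) + ∑[ c ≤ 0 ] h (suc k ℕ.+ c) (suc k)
      ≈⟨ ∙-cong (∑-cong k extend) (reflexive (≡.cong (λ n → ∑[ c ≤ n ] h (suc k ℕ.+ c) (suc k)) (≡.sym (n∸n≡0 k)))) ⟩
    ∑[ b ≤ suc k ] ∑[ c ≤ suc k ∸ b ] h (b ℕ.+ c) b ∎
    where
    column : ℕ → Carrier
    column b = ∑[ c ≤ k ∸ b ] h (b ℕ.+ c) b
    extend : ∀ b → b ≤ k → column b + h (suc k) b ≈ ∑[ c ≤ suc k ∸ b ] h (b ℕ.+ c) b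
    extend b b≤k rewrite +-∸-assoc 1 b≤k =
      ∙-congˡ (reflexive (≡.cong (λ a → h a b) (≡.sym (≡.trans (+-suc b (k ∸ b)) (≡.cong suc (m+[n∸m]≡n b≤k))))))

module Convolution {c ℓ} (R : CommutativeSemiring c ℓ) where

  open CommutativeSemiring R
  open Sums +-commutativeMonoid public

  infix  4 _≋_
  infixl 7 _✶_

  _≋_ : Rel (ℕ → Carrier) ℓ
  u ≋ v = ∀ i → u i ≈ v i

  _✶_ : Op₂ (ℕ → Carrier)
  (u ✶ v) i = ∑[ a ≤ i ] (u a * v (i ∸ a))

  monomial : Carrier → ℕ → ℕ → Carrier
  monomial x a i = if i ≡ᵇ a then x else 0#

  shift : ℕ → (ℕ → Carrier) → ℕ → Carrier
  shift a u i = if a ≤ᵇ i then u (i ∸ a) else 0#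

  monomial-≢ : ∀ x {a i} → i ≢ a → monomial x a i ≈ 0#
  monomial-≢ x i≢a = reflexive (≡.cong (if_then x else 0#) (≡ᵇ-false i≢a))

  monomial-≡ : ∀ x a → monomial x a a ≈ x
  monomial-≡ x a with a ≡ᵇ a | ≡ᵇ-reflects-≡ a a
  ... | true  | _      = refl
  ... | false | ofⁿ ¬p = contradiction ≡.refl ¬p

  ∑-*ˡ : ∀ k x (f : ℕ → Carrier) → x * ∑≤ k f ≈ ∑[ i ≤ k ] (x * f i)
  ∑-*ˡ zero    x f = refl
  ∑-*ˡ (suc k) x f = trans (distribˡ x _ _) (+-congʳ (∑-*ˡ k x f))

  ∑-*ʳ : ∀ k x (f : ℕ → Carrier) → ∑≤ k f * x ≈ ∑[ i ≤ k ] (f i * x)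
  ∑-*ʳ k x f = trans (*-comm _ x) (trans (∑-*ˡ k x f) (∑-cong k (λ i _ → *-comm x (f i))))

  ✶-cong : ∀ {u u′ v v′} → u ≋ u′ → v ≋ v′ → u ✶ v ≋ u′ ✶ v′
  ✶-cong u≋u′ v≋v′ i = ∑-cong i (λ a _ → *-cong (u≋u′ a) (v≋v′ (i ∸ a)))

  ✶-comm : ∀ u v → u ✶ v ≋ v ✶ u
  ✶-comm u v i = trans (∑-reverse i _) (∑-cong i λ a a≤i →
    trans (*-comm _ _) (*-congʳ (reflexive (≡.cong v (m∸[m∸n]≡n a≤i)))))

  ✶-assoc : ∀ u v w → (u ✶ v) ✶ w ≋ u ✶ (v ✶ w)
  ✶-assoc u v w i = begin
    ∑[ a ≤ i ] (∑[ b ≤ a ] (u b * v (a ∸ b)) * w (i ∸ a))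
      ≈⟨ ∑-cong i (λ a _ → ∑-*ʳ a (w (i ∸ a)) _) ⟩
    ∑[ a ≤ i ] ∑[ b ≤ a ] (u b * v (a ∸ b) * w (i ∸ a))
      ≈⟨ ∑-triangle i _ ⟩
    ∑[ b ≤ i ] ∑[ c ≤ i ∸ b ] (u b * v (b ℕ.+ c ∸ b) * w (i ∸ (b ℕ.+ c)))
      ≈⟨ ∑-cong i (λ b _ → ∑-cong (i ∸ b) (λ c _ → trans (*-assoc _ _ _)
           (*-congˡ (*-cong (reflexive (≡.cong v (m+n∸m≡n b c)))
                            (reflexive (≡.cong w (≡.sym (∸-+-assoc i b c)))))))) ⟩
    ∑[ b ≤ i ] ∑[ c ≤ i ∸ b ] (u b * (v c * w (i ∸ b ∸ c)))
      ≈⟨ ∑-cong i (λ b _ → sym (∑-*ˡ (i ∸ b) (u b) _)) ⟩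
    (u ✶ (v ✶ w)) i ∎
    where open SetoidReasoning setoid

  ✶-distribʳ : ∀ w u v → (λ i → u i + v i) ✶ w ≋ λ i → (u ✶ w) i + (v ✶ w) i
  ✶-distribʳ w u v i = trans (∑-cong i (λ a _ → distribʳ _ _ _)) (∑-distrib-+ i _ _)

  ✶-zeroˡ : ∀ u → (λ _ → 0#) ✶ u ≋ λ _ → 0#
  ✶-zeroˡ u i = ∑-zero i _ (λ a _ → zeroˡ _)

  ✶-monomial : ∀ u x a → u ✶ monomial x a ≋ shift a (λ i → u i * x)
  ✶-monomial u x a i with a ≤ᵇ i | ≤ᵇ-reflects-≤ a i
  ... | true  | ofʸ a≤i = begin
    (u ✶ monomial x a) i         ≈⟨ ✶-comm u _ i ⟩
    (monomial x a ✶ u) i         ≈⟨ ∑-single a _ a≤i (λ b _ b≢a → trans (*-congʳ (monomial-≢ x b≢a)) (zeroˡ _)) ⟩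
    monomial x a a * u (i ∸ a)   ≈⟨ trans (*-congʳ (monomial-≡ x a)) (*-comm x _) ⟩
    u (i ∸ a) * x                ∎
    where open SetoidReasoning setoid
  ... | false | ofⁿ a≰i = ∑-zero i _ (λ b b≤i →
    trans (*-congˡ (monomial-≢ x (λ i∸b≡a → a≰i (≡.subst (_≤ i) i∸b≡a (ℕ.m∸n≤m i b))))) (zeroʳ _))

  ✶-identityʳ : ∀ u → u ✶ monomial 1# 0 ≋ u
  ✶-identityʳ u i = trans (✶-monomial u 1# 0 i) (*-identityʳ (u i))

  ✶-commutativeSemiring : CommutativeSemiring c ℓ
  ✶-commutativeSemiring = record
    { Carrier = ℕ → Carrier
    ; _≈_     = _≋_
    ; _+_     = λ u v i → u i + v i
    ; _*_     = _✶_
    ; 0#      = λ _ → 0#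
    ; 1#      = monomial 1# 0
    ; isCommutativeSemiring = Biased.isCommutativeSemiringˡ record
      { +-isCommutativeMonoid = Pointwise.isCommutativeMonoid ℕ +-isCommutativeMonoid
      ; *-isCommutativeMonoid = Biased.isCommutativeMonoidʳ record
        { isSemigroup = record
          { isMagma = record { isEquivalence = Pointwise.isEquivalence ℕ isEquivalence ; ∙-cong = ✶-cong }
          ; assoc   = ✶-assoc
          }
        ; identityʳ = ✶-identityʳ
        ; comm      = ✶-comm
        }
      ; distribʳ = ✶-distribʳ
      ; zeroˡ    = ✶-zeroˡ
      }
    }

  private
    module ⟦R⟧ = CommutativeSemiring ✶-commutativeSemiring
    module ∑ᶠ = Sums ⟦R⟧.+-commutativeMonoid

  shift-cong : ∀ a {u v} → u ≋ v → shift a u ≋ shift a v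
  shift-cong a u≋v i with a ≤ᵇ i
  ... | true  = u≋v (i ∸ a)
  ... | false = refl

  shift-+ : ∀ a u v → shift a (λ i → u i + v i) ≋ λ i → shift a u i + shift a v i
  shift-+ a u v i with a ≤ᵇ i
  ... | true  = refl
  ... | false = sym (+-identityˡ 0#)

  shift-monomial : ∀ a x b → shift a (monomial x b) ≋ monomial x (a ℕ.+ b)
  shift-monomial a x b i with a ≤ᵇ i | ≤ᵇ-reflects-≤ a i
  ... | false | ofⁿ a≰i = sym (monomial-≢ x (λ i≡a+b → a≰i (≡.subst (a ≤_) (≡.sym i≡a+b) (ℕ.m≤m+n a b))))
  ... | true  | ofʸ a≤i with i ∸ a ≡ᵇ b | ≡ᵇ-reflects-≡ (i ∸ a) b | i ≡ᵇ a ℕ.+ b | ≡ᵇ-reflects-≡ i (a ℕ.+ b)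
  ...   | true  | _        | true  | _        = refl
  ...   | false | _        | false | _        = refl
  ...   | true  | ofʸ i∸a≡b | false | ofⁿ i≢a+b =
    contradiction (≡.trans (≡.sym (m+[n∸m]≡n a≤i)) (≡.cong (a ℕ.+_) i∸a≡b)) i≢a+b
  ...   | false | ofⁿ i∸a≢b | true  | ofʸ i≡a+b =
    contradiction (≡.trans (≡.cong (_∸ a) i≡a+b) (m+n∸m≡n a b)) i∸a≢b

  shift-∑ : ∀ a k (w : ℕ → ℕ → Carrier) → shift a (∑ᶠ.∑≤ k w) ≋ ∑ᶠ.∑[ j ≤ k ] shift a (w j)
  shift-∑ a zero    w i = refl
  shift-∑ a (suc k) w i = trans (shift-+ a (∑ᶠ.∑≤ k w) (w (suc k)) i) (+-congʳ (shift-∑ a k w i))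

  private
    δ : ℕ → ℕ → Carrier
    δ = monomial 1#

    shift≋✶δ : ∀ a u → shift a u ≋ u ✶ δ a
    shift≋✶δ a u i = sym (trans (✶-monomial u 1# a i) (shift-cong a (λ i → *-identityʳ (u i)) i))

    δ✶δ : ∀ a b → δ a ✶ δ b ≋ δ (a ℕ.+ b)
    δ✶δ a b = ⟦R⟧.trans (✶-comm (δ a) (δ b)) (⟦R⟧.trans (⟦R⟧.sym (shift≋✶δ a (δ b))) (shift-monomial a 1# b))

  shift-✶ : ∀ a b u v → shift a u ✶ shift b v ≋ shift (a ℕ.+ b) (u ✶ v)
  shift-✶ a b u v = begin
    shift a u ✶ shift b v         ≈⟨ ✶-cong (shift≋✶δ a u) (shift≋✶δ b v) ⟩
    (u ✶ δ a) ✶ (v ✶ δ b)         ≈⟨ interchange u (δ a) v (δ b) ⟩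
    (u ✶ v) ✶ (δ a ✶ δ b)         ≈⟨ ✶-cong {u ✶ v} ⟦R⟧.refl (δ✶δ a b) ⟩
    (u ✶ v) ✶ δ (a ℕ.+ b)         ≈⟨ ⟦R⟧.sym (shift≋✶δ (a ℕ.+ b) (u ✶ v)) ⟩
    shift (a ℕ.+ b) (u ✶ v)       ∎
    where open SetoidReasoning ⟦R⟧.setoid
          open CommutativeSemigroupProperties ⟦R⟧.*-commutativeSemigroup using (interchange)

-- Power series in z and q

module ℤ⟦q⟧ = Convolution ℤ.+-*-commutativeSemiring
module ℤ⟦q⟧⟦z⟧ = Convolution ℤ⟦q⟧.✶-commutativeSemiring
module 𝕊 = CommutativeSemiring ℤ⟦q⟧⟦z⟧.✶-commutativeSemiring

open ℤ⟦q⟧⟦z⟧ using (_✶_)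

infix 4 _≃_
_≃_ : Rel Series 0ℓ
_≃_ = ℤ⟦q⟧⟦z⟧._≋_

∑≡sumTo : ∀ k f → ℤ⟦q⟧.∑≤ k f ≡ sumTo k f
∑≡sumTo zero    f = ≡.refl
∑≡sumTo (suc k) f = ≡.cong (ℤ._+ f (suc k)) (∑≡sumTo k f)

sumTo-cong : ∀ k {f g : ℕ → ℤ} → (∀ i → i ≤ k → f i ≡ g i) → sumTo k f ≡ sumTo k g
sumTo-cong k {f} {g} f≡g = ≡.trans (≡.sym (∑≡sumTo k f)) (≡.trans (ℤ⟦q⟧.∑-cong k f≡g) (∑≡sumTo k g))

⊗-congʳ-below : ∀ f {g h} m n → (∀ a b → a ≤ m → b ≤ n → g a b ≡ h a b) → (f ⊗ g) m n ≡ (f ⊗ h) m n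
⊗-congʳ-below f m n g≡h = sumTo-cong m λ a _ → sumTo-cong n λ b _ →
  ≡.cong (f a b ℤ.*_) (g≡h (m ∸ a) (n ∸ b) (ℕ.m∸n≤m m a) (ℕ.m∸n≤m n b))

∑-coeff : ∀ k (w : ℕ → ℕ → ℤ) n → ℤ⟦q⟧⟦z⟧.∑≤ k w n ≡ ℤ⟦q⟧.∑≤ k (λ i → w i n)
∑-coeff zero    w n = ≡.refl
∑-coeff (suc k) w n = ≡.cong (ℤ._+ w (suc k) n) (∑-coeff k w n)

⊗≃✶ : ∀ f g → f ⊗ g ≃ f ✶ g
⊗≃✶ f g m n = begin
  sumTo m (λ a → sumTo n (λ b → f a b ℤ.* g (m ∸ a) (n ∸ b)))
    ≡⟨ ≡.sym (∑≡sumTo m _) ⟩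
  ℤ⟦q⟧.∑≤ m (λ a → sumTo n (λ b → f a b ℤ.* g (m ∸ a) (n ∸ b)))
    ≡⟨ ℤ⟦q⟧.∑-cong m (λ a _ → ≡.sym (∑≡sumTo n _)) ⟩
  ℤ⟦q⟧.∑≤ m (λ a → (f a ℤ⟦q⟧.✶ g (m ∸ a)) n)
    ≡⟨ ≡.sym (∑-coeff m _ n) ⟩
  (f ✶ g) m n ∎
  where open ≡.≡-Reasoning

⊗-cong : ∀ {f f′ g g′} → f ≃ f′ → g ≃ g′ → f ⊗ g ≃ f′ ⊗ g′
⊗-cong {f} {f′} {g} {g′} f≃f′ g≃g′ = begin
  f ⊗ g     ≈⟨ ⊗≃✶ f g ⟩
  f ✶ g     ≈⟨ ℤ⟦q⟧⟦z⟧.✶-cong f≃f′ g≃g′ ⟩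
  f′ ✶ g′   ≈⟨ 𝕊.sym (⊗≃✶ f′ g′) ⟩
  f′ ⊗ g′   ∎
  where open SetoidReasoning 𝕊.setoid

⊗-congˡ : ∀ f {g g′} → g ≃ g′ → f ⊗ g ≃ f ⊗ g′
⊗-congˡ f = ⊗-cong (𝕊.refl {f})

⊗-congʳ : ∀ {f f′} g → f ≃ f′ → f ⊗ g ≃ f′ ⊗ g
⊗-congʳ g f≃f′ = ⊗-cong f≃f′ (𝕊.refl {g})

⊗-comm : ∀ f g → f ⊗ g ≃ g ⊗ f
⊗-comm f g = begin
  f ⊗ g     ≈⟨ ⊗≃✶ f g ⟩
  f ✶ g     ≈⟨ ℤ⟦q⟧⟦z⟧.✶-comm f g ⟩
  g ✶ f     ≈⟨ 𝕊.sym (⊗≃✶ g f) ⟩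
  g ⊗ f     ∎
  where open SetoidReasoning 𝕊.setoid

⊗-assoc : ∀ f g h → (f ⊗ g) ⊗ h ≃ f ⊗ (g ⊗ h)
⊗-assoc f g h = begin
  (f ⊗ g) ⊗ h   ≈⟨ ⊗≃✶ (f ⊗ g) h ⟩
  (f ⊗ g) ✶ h   ≈⟨ ℤ⟦q⟧⟦z⟧.✶-cong (⊗≃✶ f g) (𝕊.refl {h}) ⟩
  (f ✶ g) ✶ h   ≈⟨ ℤ⟦q⟧⟦z⟧.✶-assoc f g h ⟩
  f ✶ (g ✶ h)   ≈⟨ ℤ⟦q⟧⟦z⟧.✶-cong (𝕊.refl {f}) (𝕊.sym (⊗≃✶ g h)) ⟩
  f ✶ (g ⊗ h)   ≈⟨ 𝕊.sym (⊗≃✶ f (g ⊗ h)) ⟩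
  f ⊗ (g ⊗ h)   ∎
  where open SetoidReasoning 𝕊.setoid

⊗-distribˡ : ∀ f g h → f ⊗ (g ⊕ h) ≃ (f ⊗ g) ⊕ (f ⊗ h)
⊗-distribˡ f g h = begin
  f ⊗ (g ⊕ h)       ≈⟨ ⊗≃✶ f (g ⊕ h) ⟩
  f ✶ (g ⊕ h)       ≈⟨ 𝕊.distribˡ f g h ⟩
  (f ✶ g) ⊕ (f ✶ h) ≈⟨ 𝕊.+-cong (𝕊.sym (⊗≃✶ f g)) (𝕊.sym (⊗≃✶ f h)) ⟩
  (f ⊗ g) ⊕ (f ⊗ h) ∎
  where open SetoidReasoning 𝕊.setoid

one≃1# : one ≃ 𝕊.1#
one≃1# zero    n = ≡.refl
one≃1# (suc m) n = ≡.refl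

⊗-identityʳ : ∀ f → f ⊗ one ≃ f
⊗-identityʳ f = begin
  f ⊗ one   ≈⟨ ⊗-congˡ f one≃1# ⟩
  f ⊗ 𝕊.1#  ≈⟨ ⊗≃✶ f 𝕊.1# ⟩
  f ✶ 𝕊.1#  ≈⟨ 𝕊.*-identityʳ f ⟩
  f         ∎
  where open SetoidReasoning 𝕊.setoid

⊗-identityˡ : ∀ f → one ⊗ f ≃ f
⊗-identityˡ f = 𝕊.trans (⊗-comm one f) (⊗-identityʳ f)

⊗-commutativeMonoid : CommutativeMonoid 0ℓ 0ℓ
⊗-commutativeMonoid = record
  { Carrier = Series
  ; _≈_     = _≃_
  ; _∙_     = _⊗_
  ; ε       = one
  ; isCommutativeMonoid = Biased.isCommutativeMonoidʳ record
    { isSemigroup = record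
      { isMagma = record { isEquivalence = 𝕊.isEquivalence ; ∙-cong = ⊗-cong }
      ; assoc   = ⊗-assoc
      }
    ; identityʳ = ⊗-identityʳ
    ; comm      = ⊗-comm
    }
  }

mono≃monomial : ∀ c a b → mono c a b ≃ ℤ⟦q⟧⟦z⟧.monomial (ℤ⟦q⟧.monomial c b) a
mono≃monomial c a b m n with m ≡ᵇ a
... | true  = ≡.refl
... | false = ≡.refl

⊗-mono : ∀ f c a b m n →
         (f ⊗ mono c a b) m n ≡ (if (a ≤ᵇ m) ∧ (b ≤ᵇ n) then f (m ∸ a) (n ∸ b) ℤ.* c else + 0)
⊗-mono f c a b m n = begin
  (f ⊗ mono c a b) m n
    ≡⟨ ⊗-congˡ f (mono≃monomial c a b) m n ⟩
  (f ⊗ ℤ⟦q⟧⟦z⟧.monomial (ℤ⟦q⟧.monomial c b) a) m n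
    ≡⟨ ⊗≃✶ f (ℤ⟦q⟧⟦z⟧.monomial (ℤ⟦q⟧.monomial c b) a) m n ⟩
  (f ✶ ℤ⟦q⟧⟦z⟧.monomial (ℤ⟦q⟧.monomial c b) a) m n
    ≡⟨ ℤ⟦q⟧⟦z⟧.✶-monomial f _ a m n ⟩
  ℤ⟦q⟧⟦z⟧.shift a (λ i → f i ℤ⟦q⟧.✶ ℤ⟦q⟧.monomial c b) m n
    ≡⟨ ℤ⟦q⟧⟦z⟧.shift-cong a (λ i → ℤ⟦q⟧.✶-monomial (f i) c b) m n ⟩
  ℤ⟦q⟧⟦z⟧.shift a (λ i → ℤ⟦q⟧.shift b (λ k → f i k ℤ.* c)) m n
    ≡⟨ shift-shift (a ≤ᵇ m) ⟩
  (if (a ≤ᵇ m) ∧ (b ≤ᵇ n) then f (m ∸ a) (n ∸ b) ℤ.* c else + 0) ∎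
  where
  open ≡.≡-Reasoning
  shift-shift : ∀ t → (if t then ℤ⟦q⟧.shift b (λ k → f (m ∸ a) k ℤ.* c) else (λ _ → + 0)) n
                      ≡ (if t ∧ (b ≤ᵇ n) then f (m ∸ a) (n ∸ b) ℤ.* c else + 0)
  shift-shift true  = ≡.refl
  shift-shift false = ≡.refl

⊗-binomial : ∀ f c a b m n →
             (f ⊗ (one ⊕ mono c a b)) m n ≡ f m n ℤ.+ (if (a ≤ᵇ m) ∧ (b ≤ᵇ n) then f (m ∸ a) (n ∸ b) ℤ.* c else + 0)
⊗-binomial f c a b m n =
  ≡.trans (⊗-distribˡ f one (mono c a b) m n) (≡.cong₂ ℤ._+_ (⊗-identityʳ f m n) (⊗-mono f c a b m n))

-- σ f (z, q) = f (z q, q)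
σ : Series → Series
σ f m = ℤ⟦q⟧.shift m (f m)

σ-cong : ∀ {f g} → f ≃ g → σ f ≃ σ g
σ-cong f≃g m = ℤ⟦q⟧.shift-cong m (f≃g m)

σ-⊕ : ∀ f g → σ (f ⊕ g) ≃ σ f ⊕ σ g
σ-⊕ f g m = ℤ⟦q⟧.shift-+ m (f m) (g m)

σ-mono : ∀ c a b → σ (mono c a b) ≃ mono c a (a ℕ.+ b)
σ-mono c a b m n with m ≡ᵇ a | ≡ᵇ-reflects-≡ m a
... | true  | ofʸ ≡.refl = ℤ⟦q⟧.shift-monomial m c b n
... | false | _ with m ≤ᵇ n
...   | true  = ≡.refl
...   | false = ≡.refl

σ-✶ : ∀ f g → σ (f ✶ g) ≃ σ f ✶ σ g
σ-✶ f g m = begin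
  ℤ⟦q⟧.shift m (ℤ⟦q⟧⟦z⟧.∑[ a ≤ m ] (f a ℤ⟦q⟧.✶ g (m ∸ a)))
    ≈⟨ ℤ⟦q⟧.shift-∑ m m _ ⟩
  ℤ⟦q⟧⟦z⟧.∑[ a ≤ m ] ℤ⟦q⟧.shift m (f a ℤ⟦q⟧.✶ g (m ∸ a))
    ≈⟨ ℤ⟦q⟧⟦z⟧.∑-cong m split-shift ⟩
  ℤ⟦q⟧⟦z⟧.∑[ a ≤ m ] (ℤ⟦q⟧.shift a (f a) ℤ⟦q⟧.✶ ℤ⟦q⟧.shift (m ∸ a) (g (m ∸ a))) ∎
  where
  open SetoidReasoning (CommutativeSemiring.setoid ℤ⟦q⟧.✶-commutativeSemiring)
  split-shift : ∀ a → a ≤ m →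
                ℤ⟦q⟧.shift m (f a ℤ⟦q⟧.✶ g (m ∸ a)) ℤ⟦q⟧.≋ ℤ⟦q⟧.shift a (f a) ℤ⟦q⟧.✶ ℤ⟦q⟧.shift (m ∸ a) (g (m ∸ a))
  split-shift a a≤m n = ≡.trans (≡.cong (λ k → ℤ⟦q⟧.shift k (f a ℤ⟦q⟧.✶ g (m ∸ a)) n) (≡.sym (m+[n∸m]≡n a≤m)))
                                (≡.sym (ℤ⟦q⟧.shift-✶ a (m ∸ a) (f a) (g (m ∸ a)) n))

σ-⊗ : ∀ f g → σ (f ⊗ g) ≃ σ f ⊗ σ g
σ-⊗ f g = begin
  σ (f ⊗ g)   ≈⟨ σ-cong (⊗≃✶ f g) ⟩
  σ (f ✶ g)   ≈⟨ σ-✶ f g ⟩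
  σ f ✶ σ g   ≈⟨ 𝕊.sym (⊗≃✶ (σ f) (σ g)) ⟩
  σ f ⊗ σ g   ∎
  where open SetoidReasoning 𝕊.setoid

-- The coefficient of zᵐ qⁿ in g ⊗ σ U involves U only through its z⁰-part and through
-- coefficients of q-degree below n.
σ-equation-unique : ∀ g {U V} → U ≃ g ⊗ σ U → V ≃ g ⊗ σ V → (∀ n → U 0 n ≡ V 0 n) → U ≃ V
σ-equation-unique g {U} {V} U≃gσU V≃gσV row₀ m n = <-rec (λ n → ∀ m → U m n ≡ V m n) step n m
  where
  step : ∀ n → (∀ {n′} → n′ < n → ∀ m → U m n′ ≡ V m n′) → ∀ m → U m n ≡ V m n
  step n below m = begin
    U m n             ≡⟨ U≃gσU m n ⟩
    (g ⊗ σ U) m n     ≡⟨ ⊗-congʳ-below g m n (λ a b _ b≤n → σ-agree a b b≤n) ⟩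
    (g ⊗ σ V) m n     ≡⟨ ≡.sym (V≃gσV m n) ⟩
    V m n             ∎
    where
    open ≡.≡-Reasoning
    σ-agree : ∀ a b → b ≤ n → σ U a b ≡ σ V a b
    σ-agree zero    b _   = row₀ b
    σ-agree (suc a) b b≤n with suc a ≤ᵇ b | ≤ᵇ-reflects-≤ (suc a) b
    ... | true  | ofʸ a<b = below (ℕ.<-≤-trans (∸-monoʳ-< (s≤s z≤n) a<b) b≤n) (suc a)
    ... | false | _       = ≡.refl

-- Infinite products

Convergent : (ℕ → Series) → Set
Convergent F = ∀ i m n → n ≤ i → F i m n ≡ one m n

Convergent-drop : ∀ {F} a → Convergent F → Convergent (λ i → F (a ℕ.+ i))
Convergent-drop a conv i m n n≤i = conv (a ℕ.+ i) m n (≤-trans n≤i (ℕ.m≤n+m i a))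

prodBelow-stable : ∀ {F} → Convergent F → ∀ K m n → n ≤ K → prodBelow K F m n ≡ prodBelow n F m n
prodBelow-stable conv zero    m zero z≤n = ≡.refl
prodBelow-stable {F} conv (suc K) m n n≤1+K with m≤n⇒m<n∨m≡n n≤1+K
... | inj₂ ≡.refl    = ≡.refl
... | inj₁ (s≤s n≤K) = begin
  (prodBelow K F ⊗ F K) m n  ≡⟨ ⊗-congʳ-below (prodBelow K F) m n (λ a b _ b≤n → conv K a b (≤-trans b≤n n≤K)) ⟩
  (prodBelow K F ⊗ one) m n  ≡⟨ ⊗-identityʳ (prodBelow K F) m n ⟩
  prodBelow K F m n          ≡⟨ prodBelow-stable conv K m n n≤K ⟩
  prodBelow n F m n          ∎
  where open ≡.≡-Reasoning

infProd≡prodBelow : ∀ {F} → Convergent F → ∀ K m n → n ≤ K → infProd F m n ≡ prodBelow K F m n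
infProd≡prodBelow conv K m n n≤K =
  ≡.trans (prodBelow-stable conv (suc n) m n (ℕ.n≤1+n n)) (≡.sym (prodBelow-stable conv K m n n≤K))

prodBelow-cong : ∀ {F G} → (∀ i → F i ≃ G i) → ∀ K → prodBelow K F ≃ prodBelow K G
prodBelow-cong F≃G zero    = 𝕊.refl {one}
prodBelow-cong F≃G (suc K) = ⊗-cong (prodBelow-cong F≃G K) (F≃G K)

infProd-cong : ∀ {F G} → (∀ i → F i ≃ G i) → infProd F ≃ infProd G
infProd-cong F≃G m n = prodBelow-cong F≃G (suc n) m n

prodBelow-uncons : ∀ F K → prodBelow (suc K) F ≃ F 0 ⊗ prodBelow K (λ i → F (suc i))
prodBelow-uncons F zero    = ⊗-comm one (F 0)
prodBelow-uncons F (suc K) =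
  𝕊.trans (⊗-congʳ (F (suc K)) (prodBelow-uncons F K)) (⊗-assoc (F 0) (prodBelow K (λ i → F (suc i))) (F (suc K)))

infProd-uncons : ∀ {F} → Convergent F → infProd F ≃ F 0 ⊗ infProd (λ i → F (suc i))
infProd-uncons {F} conv m n = ≡.trans (prodBelow-uncons F n m n)
  (⊗-congʳ-below (F 0) {prodBelow n (λ i → F (suc i))} {infProd (λ i → F (suc i))} m n λ a b _ b≤n →
  ≡.sym (infProd≡prodBelow (Convergent-drop 1 conv) n a b b≤n))

infProd-split : ∀ {F} → Convergent F → ∀ a → infProd F ≃ prodBelow a F ⊗ infProd (λ i → F (a ℕ.+ i))
infProd-split {F} conv zero    = 𝕊.sym (⊗-identityˡ (infProd F))
infProd-split {F} conv (suc a) = begin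
  infProd F
    ≈⟨ infProd-split conv a ⟩
  prodBelow a F ⊗ infProd (λ i → F (a ℕ.+ i))
    ≈⟨ ⊗-congˡ (prodBelow a F) (infProd-uncons (Convergent-drop a conv)) ⟩
  prodBelow a F ⊗ (F (a ℕ.+ 0) ⊗ infProd (λ i → F (a ℕ.+ suc i)))
    ≈⟨ ⊗-congˡ (prodBelow a F) (⊗-cong (𝕊.reflexive (≡.cong F (ℕ.+-identityʳ a)))
                                        (infProd-cong (λ i → 𝕊.reflexive (≡.cong F (+-suc a i))))) ⟩
  prodBelow a F ⊗ (F a ⊗ infProd (λ i → F (suc a ℕ.+ i)))
    ≈⟨ 𝕊.sym (⊗-assoc (prodBelow a F) (F a) (infProd (λ i → F (suc a ℕ.+ i)))) ⟩
  prodBelow (suc a) F ⊗ infProd (λ i → F (suc a ℕ.+ i)) ∎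
  where open SetoidReasoning 𝕊.setoid

σ-prodBelow : ∀ F K → σ (prodBelow K F) ≃ prodBelow K (λ i → σ (F i))
σ-prodBelow F zero    = σ-mono (+ 1) 0 0
σ-prodBelow F (suc K) = 𝕊.trans (σ-⊗ (prodBelow K F) (F K)) (⊗-congʳ (σ (F K)) (σ-prodBelow F K))

σ-infProd : ∀ {F} → Convergent F → σ (infProd F) ≃ infProd (λ i → σ (F i))
σ-infProd {F} conv m n = ≡.trans (shift-agree (m ≤ᵇ n)) (σ-prodBelow F (suc n) m n)
  where
  shift-agree : ∀ t → (if t then infProd F m (n ∸ m) else + 0) ≡ (if t then prodBelow (suc n) F m (n ∸ m) else + 0)
  shift-agree true  = infProd≡prodBelow conv (suc n) m (n ∸ m) (≤-trans (ℕ.m∸n≤m n m) (ℕ.n≤1+n n))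
  shift-agree false = ≡.refl

pochFactor : ℤ → ℕ → ℕ → Series
pochFactor c a i = one ⊕ mono (- c) a (suc i)

pochFactor-convergent : ∀ c a → Convergent (pochFactor c a)
pochFactor-convergent c a i m n n≤i with n ≡ᵇ suc i | ≡ᵇ-reflects-≡ n (suc i)
... | true  | ofʸ n≡1+i = contradiction n≡1+i (<⇒≢ (s≤s n≤i))
... | false | _ rewrite ∧-zeroʳ (m ≡ᵇ a) = ℤ.+-identityʳ (one m n)

σ-pochFactor : ∀ c a i → σ (pochFactor c a i) ≃ pochFactor c a (a ℕ.+ i)
σ-pochFactor c a i = 𝕊.trans (σ-⊕ one (mono (- c) a (suc i)))
  (𝕊.+-cong (σ-mono (+ 1) 0 0) (𝕊.trans (σ-mono (- c) a (suc i)) (𝕊.reflexive (≡.cong (mono (- c) a) (+-suc a i)))))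

qPochInf-σ : ∀ c a → qPochInf c a 1 ≃ prodBelow a (pochFactor c a) ⊗ σ (qPochInf c a 1)
qPochInf-σ c a = begin
  qPochInf c a 1                                                      ≈⟨ infProd-split conv a ⟩
  prodBelow a (pochFactor c a) ⊗ infProd (λ i → pochFactor c a (a ℕ.+ i))
    ≈⟨ ⊗-congˡ (prodBelow a (pochFactor c a))
               (𝕊.trans (infProd-cong (λ i → 𝕊.sym (σ-pochFactor c a i))) (𝕊.sym (σ-infProd conv))) ⟩
  prodBelow a (pochFactor c a) ⊗ σ (qPochInf c a 1)                   ∎
  where
  open SetoidReasoning 𝕊.setoid
  conv = pochFactor-convergent c a

qPochInf-row₀ : ∀ c a n → qPochInf c (suc a) 1 0 n ≡ one 0 n
qPochInf-row₀ c a n = prodBelow-row₀ (suc n)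
  where
  prodBelow-row₀ : ∀ K → prodBelow K (pochFactor c (suc a)) 0 n ≡ one 0 n
  prodBelow-row₀ zero    = ≡.refl
  prodBelow-row₀ (suc K) = ≡.trans (⊗-binomial (prodBelow K (pochFactor c (suc a))) (- c) (suc a) (suc K) 0 n)
                                   (≡.trans (ℤ.+-identityʳ _) (prodBelow-row₀ K))

[1-zq]⊗[1+zq]≃[1-z²q²] : pochFactor (+ 1) 1 0 ⊗ pochFactor (- + 1) 1 0 ≃ pochFactor (+ 1) 2 1
[1-zq]⊗[1+zq]≃[1-z²q²] m n = ≡.trans (⊗-binomial (pochFactor (+ 1) 1 0) (+ 1) 1 1 m n) (coefficients m n)
  where
  coefficients : ∀ m n →
    pochFactor (+ 1) 1 0 m n ℤ.+ (if (1 ≤ᵇ m) ∧ (1 ≤ᵇ n) then pochFactor (+ 1) 1 0 (m ∸ 1) (n ∸ 1) ℤ.* + 1 else + 0)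
    ≡ pochFactor (+ 1) 2 1 m n
  coefficients 0 0 = ≡.refl
  coefficients 0 1 = ≡.refl
  coefficients 0 2 = ≡.refl
  coefficients 0 (suc (suc (suc n))) = ≡.refl
  coefficients 1 0 = ≡.refl
  coefficients 1 1 = ≡.refl
  coefficients 1 2 = ≡.refl
  coefficients 1 (suc (suc (suc n))) = ≡.refl
  coefficients 2 0 = ≡.refl
  coefficients 2 1 = ≡.refl
  coefficients 2 2 = ≡.refl
  coefficients 2 (suc (suc (suc n))) = ≡.refl
  coefficients (suc (suc (suc m))) 0 = ≡.refl
  coefficients (suc (suc (suc m))) 1 = ≡.refl
  coefficients (suc (suc (suc m))) 2 = ≡.refl
  coefficients (suc (suc (suc m))) (suc (suc (suc n))) = ≡.refl

-- Counting sequences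

module ℕ∑ = Sums ℕ.+-0-commutativeMonoid
open ℕ∑ using (∑≤)

∑seq : ℕ → ℕ → (List ℕ → ℕ) → ℕ
∑seq zero    k F = F []
∑seq (suc m) k F = ∑[ x ≤ k ] ∑seq m k (λ xs → F (x ∷ xs))

∑seq-cong : ∀ m k {F G : List ℕ → ℕ} → (∀ xs → length xs ≡ m → F xs ≡ G xs) → ∑seq m k F ≡ ∑seq m k G
∑seq-cong zero    k F≡G = F≡G [] ≡.refl
∑seq-cong (suc m) k F≡G = ℕ∑.∑-cong k λ x _ → ∑seq-cong m k λ xs ∣xs∣≡m → F≡G (x ∷ xs) (≡.cong suc ∣xs∣≡m)

∑seq-zero : ∀ m k (F : List ℕ → ℕ) → (∀ xs → F xs ≡ 0) → ∑seq m k F ≡ 0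
∑seq-zero zero    k F F≡0 = F≡0 []
∑seq-zero (suc m) k F F≡0 = ℕ∑.∑-zero k _ λ x _ → ∑seq-zero m k _ λ xs → F≡0 (x ∷ xs)

∑seq-distrib-+ : ∀ m k (F G : List ℕ → ℕ) → ∑seq m k (λ xs → F xs ℕ.+ G xs) ≡ ∑seq m k F ℕ.+ ∑seq m k G
∑seq-distrib-+ zero    k F G = ≡.refl
∑seq-distrib-+ (suc m) k F G = ≡.trans (ℕ∑.∑-cong k λ x _ → ∑seq-distrib-+ m k _ _) (ℕ∑.∑-distrib-+ k _ _)

∑seq-snoc : ∀ m k (F : List ℕ → ℕ) → ∑seq (suc m) k F ≡ ∑seq m k (λ xs → ∑[ x ≤ k ] F (xs ++ x ∷ []))
∑seq-snoc zero    k F = ≡.refl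
∑seq-snoc (suc m) k F = ℕ∑.∑-cong k λ y _ → ∑seq-snoc m k (λ xs → F (y ∷ xs))

∑seq-bound-suc : ∀ m k (F : List ℕ → ℕ) → (∀ xs → ¬ All (_≤ k) xs → F xs ≡ 0) → ∑seq m (suc k) F ≡ ∑seq m k F
∑seq-bound-suc zero    k F F≡0 = ≡.refl
∑seq-bound-suc (suc m) k F F≡0 = begin
  ∑[ x ≤ k ] ∑seq m (suc k) (λ xs → F (x ∷ xs)) ℕ.+ ∑seq m (suc k) (λ xs → F (suc k ∷ xs))
    ≡⟨ ≡.cong₂ ℕ._+_ (ℕ∑.∑-cong k λ x x≤k → ∑seq-bound-suc m k _ λ xs ¬xs≤k → F≡0 (x ∷ xs) λ { (_ ∷ xs≤k) → ¬xs≤k xs≤k })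
                      (∑seq-zero m (suc k) _ λ xs → F≡0 (suc k ∷ xs) λ { (1+k≤k ∷ _) → ℕ.1+n≰n 1+k≤k }) ⟩
  ∑[ x ≤ k ] ∑seq m k (λ xs → F (x ∷ xs)) ℕ.+ 0
    ≡⟨ ℕ.+-identityʳ _ ⟩
  ∑seq (suc m) k F ∎
  where open ≡.≡-Reasoning

∑seq-bound : ∀ m {k k′} (F : List ℕ → ℕ) → (∀ xs → ¬ All (_≤ k) xs → F xs ≡ 0) → k ≤ k′ → ∑seq m k′ F ≡ ∑seq m k F
∑seq-bound m {k} {k′} F F≡0 k≤k′ with m≤n⇒m<n∨m≡n k≤k′
... | inj₂ ≡.refl = ≡.refl
... | inj₁ (s≤s k≤k″) = ≡.trans (∑seq-bound-suc m _ F F≡0′) (∑seq-bound m F F≡0 k≤k″)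
  where
  F≡0′ : ∀ xs → ¬ All (_≤ _) xs → F xs ≡ 0
  F≡0′ xs ¬xs≤k″ = F≡0 xs (λ xs≤k → ¬xs≤k″ (All.map (λ x≤k → ≤-trans x≤k k≤k″) xs≤k))

hasZero : List ℕ → Bool
hasZero = any (_≡ᵇ 0)

∑seq-positive : ∀ m k (F : List ℕ → ℕ) → (∀ xs → hasZero xs ≡ true → F xs ≡ 0) →
                ∑seq m (suc k) F ≡ ∑seq m k (λ xs → F (map suc xs))
∑seq-positive zero    k F F≡0 = ≡.refl
∑seq-positive (suc m) k F F≡0 = begin
  ∑[ x ≤ suc k ] ∑seq m (suc k) (λ xs → F (x ∷ xs))
    ≡⟨ ℕ∑.∑-uncons k _ ⟩
  ∑seq m (suc k) (λ xs → F (0 ∷ xs)) ℕ.+ ∑[ x ≤ k ] ∑seq m (suc k) (λ xs → F (suc x ∷ xs))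
    ≡⟨ ≡.cong₂ ℕ._+_ (∑seq-zero m (suc k) _ λ xs → F≡0 (0 ∷ xs) ≡.refl)
                      (ℕ∑.∑-cong k λ x _ → ∑seq-positive m k _ λ xs → F≡0 (suc x ∷ xs)) ⟩
  ∑seq (suc m) k (λ xs → F (map suc xs)) ∎
  where open ≡.≡-Reasoning

length-filter≡sum-𝟙 : ∀ (P : List ℕ → Bool) L → length (filter (λ xs → T? (P xs)) L) ≡ sum (map (λ xs → 𝟙 (P xs)) L)
length-filter≡sum-𝟙 P []      = ≡.refl
length-filter≡sum-𝟙 P (x ∷ L) with P x
... | true  = ≡.cong suc (length-filter≡sum-𝟙 P L)
... | false = length-filter≡sum-𝟙 P L

sum-map-upTo : ∀ (G : ℕ → ℕ) k → sum (map G (upTo (suc k))) ≡ ∑≤ k G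
sum-map-upTo G zero    = ℕ.+-identityʳ (G 0)
sum-map-upTo G (suc k) = begin
  sum (map G (upTo (suc (suc k))))          ≡⟨ ≡.cong (sum ∘ map G) (≡.sym (upTo-∷ʳ (suc k))) ⟩
  sum (map G (upTo (suc k) ∷ʳ suc k))       ≡⟨ ≡.cong sum (map-++ G (upTo (suc k)) _) ⟩
  sum (map G (upTo (suc k)) ++ G (suc k) ∷ [])
                                            ≡⟨ sum-++ (map G (upTo (suc k))) _ ⟩
  sum (map G (upTo (suc k))) ℕ.+ (G (suc k) ℕ.+ 0)
                                            ≡⟨ ≡.cong₂ ℕ._+_ (sum-map-upTo G k) (ℕ.+-identityʳ _) ⟩
  ∑≤ (suc k) G                              ∎
  where open ≡.≡-Reasoning

sum-map-concatMap : ∀ (F : List ℕ → ℕ) (g : ℕ → List (List ℕ)) L →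
                    sum (map F (concatMap g L)) ≡ sum (map (λ x → sum (map F (g x))) L)
sum-map-concatMap F g []      = ≡.refl
sum-map-concatMap F g (x ∷ L) = begin
  sum (map F (g x ++ concatMap g L))                  ≡⟨ ≡.cong sum (map-++ F (g x) _) ⟩
  sum (map F (g x) ++ map F (concatMap g L))          ≡⟨ sum-++ (map F (g x)) _ ⟩
  sum (map F (g x)) ℕ.+ sum (map F (concatMap g L))   ≡⟨ ≡.cong (sum (map F (g x)) ℕ.+_) (sum-map-concatMap F g L) ⟩
  sum (map (λ x → sum (map F (g x))) (x ∷ L))         ∎
  where open ≡.≡-Reasoning

sum-map-seqs : ∀ m k (F : List ℕ → ℕ) → sum (map F (seqs m k)) ≡ ∑seq m k F
sum-map-seqs zero    k F = ℕ.+-identityʳ (F [])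
sum-map-seqs (suc m) k F = begin
  sum (map F (concatMap (λ x → map (x ∷_) (seqs m k)) (upTo (suc k))))
    ≡⟨ sum-map-concatMap F (λ x → map (x ∷_) (seqs m k)) (upTo (suc k)) ⟩
  sum (map (λ x → sum (map F (map (x ∷_) (seqs m k)))) (upTo (suc k)))
    ≡⟨ sum-map-upTo _ k ⟩
  ∑[ x ≤ k ] sum (map F (map (x ∷_) (seqs m k)))
    ≡⟨ ℕ∑.∑-cong k (λ x _ → ≡.trans (≡.cong sum (≡.sym (map-∘ (seqs m k)))) (sum-map-seqs m k _)) ⟩
  ∑seq (suc m) k F ∎
  where open ≡.≡-Reasoning

j≡∑seq : ∀ m n → j m n ≡ ∑seq m n (λ xs → 𝟙 (is01Partition n xs))
j≡∑seq m n = ≡.trans (length-filter≡sum-𝟙 (is01Partition n) (seqs m n)) (sum-map-seqs m n _)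

-- 01-partitions and 01-sequences

entries≤sum : ∀ xs → All (_≤ sum xs) xs
entries≤sum []       = []
entries≤sum (x ∷ xs) = ℕ.m≤m+n x (sum xs) ∷ All.map (λ y≤ → ≤-trans y≤ (ℕ.m≤n+m (sum xs) x)) (entries≤sum xs)

sum≡ᵇ-false : ∀ {n} xs → ¬ All (_≤ n) xs → (sum xs ≡ᵇ n) ≡ false
sum≡ᵇ-false {n} xs ¬xs≤n with sum xs ≡ᵇ n | ≡ᵇ-reflects-≡ (sum xs) n
... | true  | ofʸ ≡.refl = contradiction (entries≤sum xs) ¬xs≤n
... | false | _          = ≡.refl

sum-map-suc : ∀ xs → sum (map suc xs) ≡ sum xs ℕ.+ length xs
sum-map-suc []       = ≡.refl
sum-map-suc (x ∷ xs) = begin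
  suc x ℕ.+ sum (map suc xs)               ≡⟨ ≡.cong (suc x ℕ.+_) (sum-map-suc xs) ⟩
  suc x ℕ.+ (sum xs ℕ.+ length xs)         ≡⟨ ≡.cong suc (≡.sym (ℕ.+-assoc x (sum xs) (length xs))) ⟩
  suc (x ℕ.+ sum xs ℕ.+ length xs)         ≡⟨ ≡.sym (+-suc (x ℕ.+ sum xs) (length xs)) ⟩
  x ℕ.+ sum xs ℕ.+ suc (length xs)         ∎
  where open ≡.≡-Reasoning

lastPos-++ : ∀ xs y ys → lastPos (xs ++ y ∷ ys) ≡ lastPos (y ∷ ys)
lastPos-++ []            y ys = ≡.refl
lastPos-++ (x ∷ [])      y ys = ≡.refl
lastPos-++ (x ∷ x′ ∷ xs) y ys = lastPos-++ (x′ ∷ xs) y ys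

lastPos-map-suc : ∀ xs → lastPos (map suc xs) ≡ true
lastPos-map-suc []           = ≡.refl
lastPos-map-suc (x ∷ [])     = ≡.refl
lastPos-map-suc (x ∷ y ∷ xs) = lastPos-map-suc (y ∷ xs)

localOK-map-suc : ∀ xs → localOK (map suc xs) ≡ localOK xs
localOK-map-suc []              = ≡.refl
localOK-map-suc (a ∷ [])        = ≡.refl
localOK-map-suc (a ∷ b ∷ [])    = ≤ᵇ-suc b (suc a)
localOK-map-suc (a ∷ b ∷ c ∷ r) =
  ≡.cong₂ _∧_ (≤ᵇ-suc b (suc a)) (≡.cong₂ _∧_ (≤ᵇ-suc c a) (localOK-map-suc (b ∷ c ∷ r)))

localOK-tail : ∀ x xs → localOK (x ∷ xs) ≡ true → localOK xs ≡ true
localOK-tail x []          _  = ≡.refl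
localOK-tail x (y ∷ [])    _  = ≡.refl
localOK-tail x (y ∷ z ∷ r) ok = proj₂ (∧-true (z ≤ᵇ x) (proj₂ (∧-true (y ≤ᵇ suc x) ok)))

localOK-suffix : ∀ xs ys → localOK (xs ++ ys) ≡ true → localOK ys ≡ true
localOK-suffix []       ys ok = ok
localOK-suffix (x ∷ xs) ys ok = localOK-suffix xs ys (localOK-tail x (xs ++ ys) ok)

localOK-∷ʳ0 : ∀ xs → localOK (xs ∷ʳ 0) ≡ localOK xs
localOK-∷ʳ0 []              = ≡.refl
localOK-∷ʳ0 (a ∷ [])        = ≡.refl
localOK-∷ʳ0 (a ∷ b ∷ [])    = ∧-identityʳ _
localOK-∷ʳ0 (a ∷ b ∷ c ∷ r) = ≡.cong (λ t → (b ≤ᵇ suc a) ∧ (c ≤ᵇ a) ∧ t) (localOK-∷ʳ0 (b ∷ c ∷ r))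

localOK-++01 : ∀ xs → localOK (xs ++ 0 ∷ 1 ∷ []) ≡ localOK xs ∧ lastPos xs
localOK-++01 []              = ≡.refl
localOK-++01 (a ∷ [])        = ∧-identityʳ _
localOK-++01 (a ∷ b ∷ [])    = ≡.cong ((b ≤ᵇ suc a) ∧_) (∧-identityʳ _)
localOK-++01 (a ∷ b ∷ c ∷ r) = begin
  (b ≤ᵇ suc a) ∧ (c ≤ᵇ a) ∧ localOK (b ∷ c ∷ r ++ 0 ∷ 1 ∷ [])
    ≡⟨ ≡.cong (λ t → (b ≤ᵇ suc a) ∧ (c ≤ᵇ a) ∧ t) (localOK-++01 (b ∷ c ∷ r)) ⟩
  (b ≤ᵇ suc a) ∧ (c ≤ᵇ a) ∧ (localOK (b ∷ c ∷ r) ∧ lastPos (b ∷ c ∷ r))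
    ≡⟨ ≡.cong ((b ≤ᵇ suc a) ∧_) (≡.sym (∧-assoc (c ≤ᵇ a) _ _)) ⟩
  (b ≤ᵇ suc a) ∧ ((c ≤ᵇ a) ∧ localOK (b ∷ c ∷ r)) ∧ lastPos (b ∷ c ∷ r)
    ≡⟨ ≡.sym (∧-assoc (b ≤ᵇ suc a) _ _) ⟩
  localOK (a ∷ b ∷ c ∷ r) ∧ lastPos (a ∷ b ∷ c ∷ r) ∎
  where open ≡.≡-Reasoning

hasZero-map-suc : ∀ xs → hasZero (map suc xs) ≡ false
hasZero-map-suc []       = ≡.refl
hasZero-map-suc (x ∷ xs) = hasZero-map-suc xs

hasZero-++0 : ∀ xs ys → hasZero (xs ++ 0 ∷ ys) ≡ true
hasZero-++0 []       ys = ≡.refl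
hasZero-++0 (x ∷ xs) ys = ≡.trans (≡.cong ((x ≡ᵇ 0) ∨_) (hasZero-++0 xs ys)) (∨-zeroʳ (x ≡ᵇ 0))

is01Sequence : ℕ → List ℕ → Bool
is01Sequence s xs = (sum xs ≡ᵇ s) ∧ localOK xs

jSeq : ℕ → ℕ → ℕ
jSeq m s = ∑seq m s (λ xs → 𝟙 (is01Sequence s xs))

jSeq-zero : ∀ s → jSeq 0 s ≡ j 0 s
jSeq-zero zero    = ≡.refl
jSeq-zero (suc s) = ≡.refl

is01Sequence-∷ʳ : ∀ s xs x →
              𝟙 (is01Sequence s (xs ∷ʳ x)) ≡ 𝟙 (is01Partition s (xs ∷ʳ x)) ℕ.+ (if x ≡ᵇ 0 then 𝟙 (is01Sequence s xs) else 0)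
is01Sequence-∷ʳ s xs zero
  rewrite lastPos-++ xs 0 [] | ∧-zeroʳ (sum (xs ∷ʳ 0) ≡ᵇ s) | sum-++ xs (0 ∷ []) | ℕ.+-identityʳ (sum xs)
        | localOK-∷ʳ0 xs = ≡.refl
is01Sequence-∷ʳ s xs (suc x) rewrite lastPos-++ xs (suc x) [] = ≡.sym (ℕ.+-identityʳ _)

jSeq-suc : ∀ m s → jSeq (suc m) s ≡ jSeq m s ℕ.+ j (suc m) s
jSeq-suc m s = begin
  jSeq (suc m) s
    ≡⟨ ∑seq-snoc m s (λ xs → 𝟙 (is01Sequence s xs)) ⟩
  ∑seq m s (λ xs → ∑[ x ≤ s ] 𝟙 (is01Sequence s (xs ∷ʳ x)))
    ≡⟨ ∑seq-cong m s (λ xs _ → last-entry xs) ⟩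
  ∑seq m s (λ xs → 𝟙 (is01Sequence s xs) ℕ.+ ∑[ x ≤ s ] 𝟙 (is01Partition s (xs ∷ʳ x)))
    ≡⟨ ∑seq-distrib-+ m s _ _ ⟩
  jSeq m s ℕ.+ ∑seq m s (λ xs → ∑[ x ≤ s ] 𝟙 (is01Partition s (xs ∷ʳ x)))
    ≡⟨ ≡.cong (jSeq m s ℕ.+_) (≡.sym (≡.trans (j≡∑seq (suc m) s) (∑seq-snoc m s (λ xs → 𝟙 (is01Partition s xs))))) ⟩
  jSeq m s ℕ.+ j (suc m) s ∎
  where
  open ≡.≡-Reasoning
  last-entry : ∀ xs →
    ∑[ x ≤ s ] 𝟙 (is01Sequence s (xs ∷ʳ x)) ≡ 𝟙 (is01Sequence s xs) ℕ.+ ∑[ x ≤ s ] 𝟙 (is01Partition s (xs ∷ʳ x))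
  last-entry xs = begin
    ∑[ x ≤ s ] 𝟙 (is01Sequence s (xs ∷ʳ x))
      ≡⟨ ℕ∑.∑-cong s (λ x _ → is01Sequence-∷ʳ s xs x) ⟩
    ∑[ x ≤ s ] (𝟙 (is01Partition s (xs ∷ʳ x)) ℕ.+ (if x ≡ᵇ 0 then 𝟙 (is01Sequence s xs) else 0))
      ≡⟨ ℕ∑.∑-distrib-+ s _ _ ⟩
    ∑[ x ≤ s ] 𝟙 (is01Partition s (xs ∷ʳ x)) ℕ.+ ∑[ x ≤ s ] (if x ≡ᵇ 0 then 𝟙 (is01Sequence s xs) else 0)
      ≡⟨ ≡.cong (∑[ x ≤ s ] 𝟙 (is01Partition s (xs ∷ʳ x)) ℕ.+_)
                (ℕ∑.∑-single {s} 0 (λ x → if x ≡ᵇ 0 then 𝟙 (is01Sequence s xs) else 0) z≤n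
                              (λ x _ x≢0 → ≡.cong (if_then 𝟙 (is01Sequence s xs) else 0) (≡ᵇ-false x≢0))) ⟩
    ∑[ x ≤ s ] 𝟙 (is01Partition s (xs ∷ʳ x)) ℕ.+ 𝟙 (is01Sequence s xs)
      ≡⟨ ℕ.+-comm (∑[ x ≤ s ] 𝟙 (is01Partition s (xs ∷ʳ x))) (𝟙 (is01Sequence s xs)) ⟩
    𝟙 (is01Sequence s xs) ℕ.+ ∑[ x ≤ s ] 𝟙 (is01Partition s (xs ∷ʳ x)) ∎

is01Partition-map-suc : ∀ m n xs → length xs ≡ m →
                       is01Partition n (map suc xs) ∧ not (hasZero (map suc xs)) ≡ (m ≤ᵇ n) ∧ is01Sequence (n ∸ m) xs
is01Partition-map-suc m n xs ≡.refl
  rewrite sum-map-suc xs | lastPos-map-suc xs | localOK-map-suc xs | hasZero-map-suc xs | +-≡ᵇ (sum xs) (length xs) n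
  = ≡.trans (∧-identityʳ _) (∧-assoc (length xs ≤ᵇ n) _ _)

count-positive-01Partitions : ∀ m n →
  ∑seq m n (λ xs → 𝟙 (is01Partition n xs ∧ not (hasZero xs))) ≡ (if m ≤ᵇ n then jSeq m (n ∸ m) else 0)
count-positive-01Partitions m n = begin
  ∑seq m n W
    ≡⟨ ≡.sym (∑seq-bound m W (λ xs ¬xs≤n → ≡.cong (λ t → 𝟙 ((t ∧ lastPos xs ∧ localOK xs) ∧ not (hasZero xs)))
                                                 (sum≡ᵇ-false xs ¬xs≤n)) (ℕ.n≤1+n n)) ⟩
  ∑seq m (suc n) W
    ≡⟨ ∑seq-positive m n W (λ xs hz → ≡.trans (≡.cong (λ t → 𝟙 (is01Partition n xs ∧ not t)) hz) (≡.cong 𝟙 (∧-zeroʳ _))) ⟩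
  ∑seq m n (λ xs → W (map suc xs))
    ≡⟨ ∑seq-cong m n (λ xs ∣xs∣≡m → ≡.cong 𝟙 (is01Partition-map-suc m n xs ∣xs∣≡m)) ⟩
  ∑seq m n (λ xs → 𝟙 ((m ≤ᵇ n) ∧ is01Sequence (n ∸ m) xs))
    ≡⟨ restrict (m ≤ᵇ n) ⟩
  (if m ≤ᵇ n then jSeq m (n ∸ m) else 0) ∎
  where
  open ≡.≡-Reasoning
  W : List ℕ → ℕ
  W xs = 𝟙 (is01Partition n xs ∧ not (hasZero xs))
  restrict : ∀ t → ∑seq m n (λ xs → 𝟙 (t ∧ is01Sequence (n ∸ m) xs)) ≡ (if t then jSeq m (n ∸ m) else 0)
  restrict false = ∑seq-zero m n _ (λ _ → ≡.refl)
  restrict true  = ∑seq-bound m (λ xs → 𝟙 (is01Sequence (n ∸ m) xs))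
                               (λ xs ¬xs≤n∸m → ≡.cong (λ t → 𝟙 (t ∧ localOK xs)) (sum≡ᵇ-false xs ¬xs≤n∸m)) (ℕ.m∸n≤m n m)

zero-propagates : ∀ w → 2 ≤ length w → localOK (0 ∷ w) ≡ true → hasZero w ≡ true
zero-propagates (u ∷ [])        (s≤s ()) _
zero-propagates (u ∷ zero ∷ r)  _ _  = ∨-zeroʳ (u ≡ᵇ 0)
zero-propagates (u ∷ suc v ∷ r) _ ok = contradiction (proj₂ (∧-true (u ≤ᵇ 1) ok)) λ ()

zero-before-last : ∀ xs a b → localOK (xs ++ a ∷ b ∷ []) ≡ true → 1 ≤ b → hasZero (xs ++ a ∷ b ∷ []) ≡ true → a ≡ 0
zero-before-last []       zero    b       _  _   _  = ≡.refl
zero-before-last []       (suc a) (suc b) _  _   ()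
zero-before-last (x ∷ xs) a       b       ok 1≤b hz =
  zero-before-last xs a b (localOK-tail x w ok) 1≤b (zero-in-tail x ok hz)
  where
  w = xs ++ a ∷ b ∷ []
  zero-in-tail : ∀ x → localOK (x ∷ w) ≡ true → hasZero (x ∷ w) ≡ true → hasZero w ≡ true
  zero-in-tail zero    ok _  = zero-propagates w (≡.subst (2 ≤_) (≡.sym (length-++ xs)) (ℕ.m≤n+m 2 (length xs))) ok
  zero-in-tail (suc x) _  hz = hz

ends-in-01 : ∀ n xs a b → is01Partition n (xs ++ a ∷ b ∷ []) ∧ hasZero (xs ++ a ∷ b ∷ []) ≡ true → a ≡ 0 × b ≡ 1
ends-in-01 n xs a b P∧hz = a≡0 , ≤-antisym b≤1 1≤b
  where
  w  = xs ++ a ∷ b ∷ []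
  P  = proj₁ (∧-true (is01Partition n w) P∧hz)
  lp∧ok = proj₂ (∧-true (sum w ≡ᵇ n) P)
  ok = proj₂ (∧-true (lastPos w) lp∧ok)
  1≤b : 1 ≤ b
  1≤b = ≤ᵇ-true⇒≤ 1 b (≡.trans (≡.sym (lastPos-++ xs a (b ∷ []))) (proj₁ (∧-true (lastPos w) lp∧ok)))
  a≡0 : a ≡ 0
  a≡0 = zero-before-last xs a b ok 1≤b (proj₂ (∧-true (is01Partition n w) P∧hz))
  b≤1 : b ≤ 1
  b≤1 = ≡.subst (λ a → b ≤ suc a) a≡0 (≤ᵇ-true⇒≤ b (suc a) (localOK-suffix xs (a ∷ b ∷ []) ok))

is01Partition-++01 : ∀ n xs → is01Partition (suc n) (xs ++ 0 ∷ 1 ∷ []) ∧ hasZero (xs ++ 0 ∷ 1 ∷ []) ≡ is01Partition n xs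
is01Partition-++01 n xs
  rewrite sum-++ xs (0 ∷ 1 ∷ []) | ℕ.+-comm (sum xs) 1 | lastPos-++ xs 0 (1 ∷ []) | localOK-++01 xs | hasZero-++0 xs (1 ∷ [])
  = ≡.trans (∧-identityʳ _) (≡.cong ((sum xs ≡ᵇ n) ∧_) (∧-comm (localOK xs) (lastPos xs)))

∑-last-two-entries : ∀ n xs →
  ∑[ a ≤ n ] ∑[ b ≤ n ] 𝟙 (is01Partition n (xs ++ a ∷ b ∷ []) ∧ hasZero (xs ++ a ∷ b ∷ []))
  ≡ 𝟙 ((1 ≤ᵇ n) ∧ is01Partition (n ∸ 1) xs)
∑-last-two-entries zero    xs = 𝟙-false λ P∧hz → contradiction (proj₂ (ends-in-01 0 xs 0 0 P∧hz)) λ ()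
∑-last-two-entries (suc n) xs = begin
  ∑[ a ≤ suc n ] ∑[ b ≤ suc n ] Z a b
    ≡⟨ ℕ∑.∑-single {suc n} 0 _ z≤n (λ a _ a≢0 →
         ℕ∑.∑-zero (suc n) _ λ b _ → 𝟙-false λ P∧hz → a≢0 (proj₁ (ends-in-01 (suc n) xs a b P∧hz))) ⟩
  ∑[ b ≤ suc n ] Z 0 b
    ≡⟨ ℕ∑.∑-single {suc n} 1 _ (s≤s z≤n) (λ b _ b≢1 → 𝟙-false λ P∧hz → b≢1 (proj₂ (ends-in-01 (suc n) xs 0 b P∧hz))) ⟩
  Z 0 1
    ≡⟨ ≡.cong 𝟙 (is01Partition-++01 n xs) ⟩
  𝟙 (is01Partition n xs) ∎
  where
  open ≡.≡-Reasoning
  Z : ℕ → ℕ → ℕ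
  Z a b = 𝟙 (is01Partition (suc n) (xs ++ a ∷ b ∷ []) ∧ hasZero (xs ++ a ∷ b ∷ []))

count-01Partitions-with-zero : ∀ m n →
  ∑seq m n (λ xs → 𝟙 (is01Partition n xs ∧ hasZero xs)) ≡ (if (2 ≤ᵇ m) ∧ (1 ≤ᵇ n) then j (m ∸ 2) (n ∸ 1) else 0)
count-01Partitions-with-zero zero          n = ≡.cong 𝟙 (∧-zeroʳ _)
count-01Partitions-with-zero (suc zero)    n = ℕ∑.∑-zero n _ λ x _ → ≡.cong 𝟙 (singleton x)
  where
  singleton : ∀ x → is01Partition n (x ∷ []) ∧ hasZero (x ∷ []) ≡ false
  singleton zero    = ≡.trans (∧-identityʳ _) (∧-zeroʳ _)
  singleton (suc x) = ∧-zeroʳ _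
count-01Partitions-with-zero (suc (suc m)) n = begin
  ∑seq (suc (suc m)) n Z
    ≡⟨ ∑seq-snoc (suc m) n Z ⟩
  ∑seq (suc m) n (λ ys → ∑[ b ≤ n ] Z (ys ∷ʳ b))
    ≡⟨ ∑seq-snoc m n (λ ys → ∑[ b ≤ n ] Z (ys ∷ʳ b)) ⟩
  ∑seq m n (λ xs → ∑[ a ≤ n ] ∑[ b ≤ n ] Z ((xs ∷ʳ a) ∷ʳ b))
    ≡⟨ ∑seq-cong m n (λ xs _ → ≡.trans (ℕ∑.∑-cong n λ a _ → ℕ∑.∑-cong n λ b _ → ≡.cong Z (++-assoc xs (a ∷ []) (b ∷ [])))
                                       (∑-last-two-entries n xs)) ⟩
  ∑seq m n (λ xs → 𝟙 ((1 ≤ᵇ n) ∧ is01Partition (n ∸ 1) xs))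
    ≡⟨ drop-guard n ⟩
  (if 1 ≤ᵇ n then j m (n ∸ 1) else 0) ∎
  where
  open ≡.≡-Reasoning
  Z : List ℕ → ℕ
  Z xs = 𝟙 (is01Partition n xs ∧ hasZero xs)
  drop-guard : ∀ n → ∑seq m n (λ xs → 𝟙 ((1 ≤ᵇ n) ∧ is01Partition (n ∸ 1) xs)) ≡ (if 1 ≤ᵇ n then j m (n ∸ 1) else 0)
  drop-guard zero    = ∑seq-zero m 0 _ (λ _ → ≡.refl)
  drop-guard (suc n) = ≡.trans (∑seq-bound m (λ xs → 𝟙 (is01Partition n xs)) vanish (ℕ.n≤1+n n)) (≡.sym (j≡∑seq m n))
    where
    vanish : ∀ xs → ¬ All (_≤ n) xs → 𝟙 (is01Partition n xs) ≡ 0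
    vanish xs ¬xs≤n = ≡.cong (λ t → 𝟙 (t ∧ lastPos xs ∧ localOK xs)) (sum≡ᵇ-false xs ¬xs≤n)

j-split : ∀ m n → j m n ≡ (if (2 ≤ᵇ m) ∧ (1 ≤ᵇ n) then j (m ∸ 2) (n ∸ 1) else 0) ℕ.+ (if m ≤ᵇ n then jSeq m (n ∸ m) else 0)
j-split m n = begin
  j m n
    ≡⟨ j≡∑seq m n ⟩
  ∑seq m n (λ xs → 𝟙 (is01Partition n xs))
    ≡⟨ ∑seq-cong m n (λ xs _ → 𝟙-split (is01Partition n xs) (hasZero xs)) ⟩
  ∑seq m n (λ xs → 𝟙 (is01Partition n xs ∧ hasZero xs) ℕ.+ 𝟙 (is01Partition n xs ∧ not (hasZero xs)))
    ≡⟨ ∑seq-distrib-+ m n _ _ ⟩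
  ∑seq m n (λ xs → 𝟙 (is01Partition n xs ∧ hasZero xs)) ℕ.+ ∑seq m n (λ xs → 𝟙 (is01Partition n xs ∧ not (hasZero xs)))
    ≡⟨ ≡.cong₂ ℕ._+_ (count-01Partitions-with-zero m n) (count-positive-01Partitions m n) ⟩
  (if (2 ≤ᵇ m) ∧ (1 ≤ᵇ n) then j (m ∸ 2) (n ∸ 1) else 0) ℕ.+ (if m ≤ᵇ n then jSeq m (n ∸ m) else 0) ∎
  where open ≡.≡-Reasoning

-- Generating functions

+-*-1-cancel : ∀ x y → + (x ℕ.+ y) ℤ.+ + x ℤ.* - + 1 ≡ + y
+-*-1-cancel x y = ≡.trans (≡.cong (λ i → i ℤ.+ + x ℤ.* - + 1) (ℤ.pos-+ x y)) (cancel (+ x) (+ y))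
  where
  cancel : ∀ i k → (i ℤ.+ k) ℤ.+ i ℤ.* - + 1 ≡ k
  cancel = solve-∀

Λ : Series
Λ m s = + jSeq m s

J⊗[1-z²q]≃σΛ : J ⊗ pochFactor (+ 1) 2 0 ≃ σ Λ
J⊗[1-z²q]≃σΛ m n = begin
  (J ⊗ pochFactor (+ 1) 2 0) m n
    ≡⟨ ⊗-binomial J (- + 1) 2 1 m n ⟩
  + j m n ℤ.+ (if (2 ≤ᵇ m) ∧ (1 ≤ᵇ n) then + j (m ∸ 2) (n ∸ 1) ℤ.* - + 1 else + 0)
    ≡⟨ ≡.cong (λ k → + k ℤ.+ correction) (j-split m n) ⟩
  + (ends01 ℕ.+ (if m ≤ᵇ n then jSeq m (n ∸ m) else 0)) ℤ.+ correction
    ≡⟨ cancel-ends01 ((2 ≤ᵇ m) ∧ (1 ≤ᵇ n)) ⟩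
  + (if m ≤ᵇ n then jSeq m (n ∸ m) else 0)
    ≡⟨ if-float +_ (m ≤ᵇ n) ⟩
  σ Λ m n ∎
  where
  open ≡.≡-Reasoning
  ends01 = if (2 ≤ᵇ m) ∧ (1 ≤ᵇ n) then j (m ∸ 2) (n ∸ 1) else 0
  correction = if (2 ≤ᵇ m) ∧ (1 ≤ᵇ n) then + j (m ∸ 2) (n ∸ 1) ℤ.* - + 1 else + 0
  cancel-ends01 : ∀ t {k} →
    + ((if t then j (m ∸ 2) (n ∸ 1) else 0) ℕ.+ k) ℤ.+ (if t then + j (m ∸ 2) (n ∸ 1) ℤ.* - + 1 else + 0) ≡ + k
  cancel-ends01 true {k} = +-*-1-cancel (j (m ∸ 2) (n ∸ 1)) k
  cancel-ends01 false = ℤ.+-identityʳ _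

Λ⊗[1-z]≃J : Λ ⊗ (one ⊕ mono (- + 1) 1 0) ≃ J
Λ⊗[1-z]≃J zero    n = ≡.trans (⊗-binomial Λ (- + 1) 1 0 0 n) (≡.trans (ℤ.+-identityʳ _) (≡.cong +_ (jSeq-zero n)))
Λ⊗[1-z]≃J (suc m) n = begin
  (Λ ⊗ (one ⊕ mono (- + 1) 1 0)) (suc m) n    ≡⟨ ⊗-binomial Λ (- + 1) 1 0 (suc m) n ⟩
  + jSeq (suc m) n ℤ.+ + jSeq m n ℤ.* - + 1 ≡⟨ ≡.cong (λ k → + k ℤ.+ + jSeq m n ℤ.* - + 1) (jSeq-suc m n) ⟩
  + (jSeq m n ℕ.+ j (suc m) n) ℤ.+ + jSeq m n ℤ.* - + 1
                                               ≡⟨ +-*-1-cancel (jSeq m n) (j (suc m) n) ⟩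
  J (suc m) n                                  ∎
  where open ≡.≡-Reasoning

J⊗[1-z²q]⊗[1-zq]≃σJ : (J ⊗ pochFactor (+ 1) 2 0) ⊗ pochFactor (+ 1) 1 0 ≃ σ J
J⊗[1-z²q]⊗[1-zq]≃σJ = begin
  (J ⊗ pochFactor (+ 1) 2 0) ⊗ pochFactor (+ 1) 1 0  ≈⟨ ⊗-cong J⊗[1-z²q]≃σΛ (𝕊.sym σ[1-z]) ⟩
  σ Λ ⊗ σ (one ⊕ mono (- + 1) 1 0)                   ≈⟨ 𝕊.sym (σ-⊗ Λ (one ⊕ mono (- + 1) 1 0)) ⟩
  σ (Λ ⊗ (one ⊕ mono (- + 1) 1 0))                   ≈⟨ σ-cong Λ⊗[1-z]≃J ⟩
  σ J                                                ∎
  where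
  open SetoidReasoning 𝕊.setoid
  σ[1-z] : σ (one ⊕ mono (- + 1) 1 0) ≃ pochFactor (+ 1) 1 0
  σ[1-z] = 𝕊.trans (σ-⊕ one (mono (- + 1) 1 0)) (𝕊.+-cong (σ-mono (+ 1) 0 0) (σ-mono (- + 1) 1 0))

J⊗[z²q]∞-σ-equation : J ⊗ qPochInf (+ 1) 2 1 ≃ pochFactor (- + 1) 1 0 ⊗ σ (J ⊗ qPochInf (+ 1) 2 1)
J⊗[z²q]∞-σ-equation = begin
  J ⊗ P                                 ≈⟨ ⊗-congˡ J (qPochInf-σ (+ 1) 2) ⟩
  J ⊗ (((one ⊗ F₀) ⊗ F₁) ⊗ σ P)         ≈⟨ ⊗-congˡ J (⊗-congʳ (σ P) (⊗-cong (⊗-identityˡ F₀) (𝕊.sym [1-zq]⊗[1+zq]≃[1-z²q²]))) ⟩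
  J ⊗ ((F₀ ⊗ (E⁻ ⊗ E⁺)) ⊗ σ P)          ≈⟨ ⊗-congˡ J (⊗-assoc F₀ (E⁻ ⊗ E⁺) (σ P)) ⟩
  J ⊗ (F₀ ⊗ ((E⁻ ⊗ E⁺) ⊗ σ P))          ≈⟨ 𝕊.sym (⊗-assoc J F₀ ((E⁻ ⊗ E⁺) ⊗ σ P)) ⟩
  (J ⊗ F₀) ⊗ ((E⁻ ⊗ E⁺) ⊗ σ P)          ≈⟨ ⊗-congˡ (J ⊗ F₀) (⊗-assoc E⁻ E⁺ (σ P)) ⟩
  (J ⊗ F₀) ⊗ (E⁻ ⊗ (E⁺ ⊗ σ P))          ≈⟨ 𝕊.sym (⊗-assoc (J ⊗ F₀) E⁻ (E⁺ ⊗ σ P)) ⟩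
  ((J ⊗ F₀) ⊗ E⁻) ⊗ (E⁺ ⊗ σ P)          ≈⟨ ⊗-congʳ (E⁺ ⊗ σ P) J⊗[1-z²q]⊗[1-zq]≃σJ ⟩
  σ J ⊗ (E⁺ ⊗ σ P)                      ≈⟨ x∙yz≈y∙xz (σ J) E⁺ (σ P) ⟩
  E⁺ ⊗ (σ J ⊗ σ P)                      ≈⟨ ⊗-congˡ E⁺ (𝕊.sym (σ-⊗ J P)) ⟩
  E⁺ ⊗ σ (J ⊗ P)                        ∎
  where
  open SetoidReasoning 𝕊.setoid
  open CommutativeSemigroupProperties (CommutativeMonoid.commutativeSemigroup ⊗-commutativeMonoid) using (x∙yz≈y∙xz)
  P  = qPochInf (+ 1) 2 1
  F₀ = pochFactor (+ 1) 2 0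
  F₁ = pochFactor (+ 1) 2 1
  E⁻ = pochFactor (+ 1) 1 0
  E⁺ = pochFactor (- + 1) 1 0

J-row₀ : ∀ n → J 0 n ≡ one 0 n
J-row₀ zero    = ≡.refl
J-row₀ (suc n) = ≡.refl

[-zq]∞-σ-equation : qPochInf (- + 1) 1 1 ≃ pochFactor (- + 1) 1 0 ⊗ σ (qPochInf (- + 1) 1 1)
[-zq]∞-σ-equation =
  𝕊.trans (qPochInf-σ (- + 1) 1) (⊗-congʳ (σ (qPochInf (- + 1) 1 1)) (⊗-identityˡ (pochFactor (- + 1) 1 0)))

J⊗[z²q]∞-row₀ : ∀ n → (J ⊗ qPochInf (+ 1) 2 1) 0 n ≡ qPochInf (- + 1) 1 1 0 n
J⊗[z²q]∞-row₀ n = begin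
  (J ⊗ qPochInf (+ 1) 2 1) 0 n  ≡⟨ ⊗-congʳ-below J {qPochInf (+ 1) 2 1} {one} 0 n (λ { .0 b z≤n _ → qPochInf-row₀ (+ 1) 1 b }) ⟩
  (J ⊗ one) 0 n                 ≡⟨ ⊗-identityʳ J 0 n ⟩
  J 0 n                         ≡⟨ J-row₀ n ⟩
  one 0 n                       ≡⟨ ≡.sym (qPochInf-row₀ (- + 1) 0 n) ⟩
  qPochInf (- + 1) 1 1 0 n      ∎
  where open ≡.≡-Reasoning

theorem16 : ∀ (m n : ℕ) → (J ⊗ qPochInf (+ 1) 2 1) m n ≡ qPochInf (- (+ 1)) 1 1 m n
theorem16 = σ-equation-unique (pochFactor (- + 1) 1 0) J⊗[z²q]∞-σ-equation [-zq]∞-σ-equation J⊗[z²q]∞-row₀
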